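{- Let $\mathcal{M}=(\Delta,M)$ and $\mathcal{M}'=(\Delta',M')$ be saturated matching configurations with coherent closures $\mathcal{Y}=(\Delta,T)$ and $\mathcal{Y}'=(\Delta',T')$, respectively, and let $\varphi:M\to M'$, $u\mapsto u'$, be an algebraic isomorphism from $\mathcal{M}$ onto $\mathcal{M}'$. Then $T=(M\cdot M)^\#$ and $T'=(M'\cdot M')^\#$, and the mapping $\psi:T\to T'$, $u\cdot v\mapsto u'\cdot v'$ ($u,v\in M$, $u\cdot v\neq\varnothing$) is a well-defined bijection. Moreover, $\psi|_M=\varphi$ and $\psi$ is an algebraic isomorphism from $\mathcal{Y}$ to $\mathcal{Y}'$.
   Context: For relations $r,s$: $r^*=\{(\beta,\alpha):(\alpha,\beta)\in r\}$, $\alpha r=\{\beta:(\alpha,\beta)\in r\}$, $r\cdot s=\{(\alpha,\gamma):\exists\beta,\ (\alpha,\beta)\in r,(\beta,\gamma)\in s\}$, $1_\Lambda=\{(\alpha,\alpha):\alpha\in\Lambda\}$; for a set of relations $M$, $M\cdot M=\{r\cdot s:r,s\in M\}$ and $(M\cdot M)^\#=(M\cdot M)\setminus\{\varnothing\}$. A partial coherent configuration is a pair $(\Delta,M)$ where $M$ is a partition of a subset of $\Delta\times\Delta$ such that $1_\Delta$ is a union of elements of $M$, $M^*=M$, and for all $r,s,t\in M$ the number $c_{rs}^t=|\alpha r\cap\beta s^*|$ does not depend on $(\alpha,\beta)\in t$; fibers are the sets $\Lambda$ with $1_\Lambda\in M$. If $M$ partitions $\Delta\times\Delta$ it is a coherent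 configuration. An algebraic isomorphism between partial coherent configurations $(\Delta,M)$, $(\Delta',M')$ is a bijection $\varphi:M\to M'$ with $c_{rs}^t=c_{\varphi(r)\varphi(s)}^{\varphi(t)}$ for all $r,s,t\in M$. A matching is a relation $\{(\alpha,f(\alpha)):\alpha\in\Lambda\}$ for a bijection $f:\Lambda\to\Lambda'$. Let the fibers of $\mathcal{M}$ be $\Delta_x$, $x\in X$; $M(x,y)$ is the set of elements of $M$ contained in $\Delta_x\times\Delta_y$, $1_x=1_{\Delta_x}$, and $x\sim y$ means $M(x,y)$ is a partition of $\Delta_x\times\Delta_y$ into matchings. $\mathcal{M}$ is a matching configuration if for all $x,y$ with $M(x,y)\ne\varnothing$, either $x\sim y$, or $x=y$ and $M(x,x)=\{1_x\}$; it is saturated if for every $Y\subseteq X$ with $|Y|\le 4$ there is $z\in X$ with $z\sim y$ for all $y\in Y$. The coherent closure of $M$ is the smallest coherent configuration $(\Delta,T)$ such that every element of $M$ is a union of elements of $T$. -}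

module Defs where

open import Data.Nat using (ℕ; _≤_)
open import Data.Fin using (Fin)
open import Data.Bool using (Bool; true; false; _∧_; if_then_else_)
open import Data.List using (List; allFin; map; length)
open import Data.Bool.ListAction using (any)
open import Data.Nat.ListAction using (sum)
open import Data.List.Relation.Unary.All using (All)
open import Data.Product using (Σ; ∃; _×_; _,_)
open import Data.Sum using (_⊎_)
open import Relation.Binary.PropositionalEquality using (_≡_; _≢_)
open import Relation.Nullary using (¬_)
import Function.Definitions as FD

-- Relations on the point set Δ = Fin n, as decidable (Bool-valued)
-- subsets of Δ × Δ.

BRel : ℕ → Set
BRel n = Fin n → Fin n → Bool

_≐_ : ∀ {n} → BRel n → BRel n → Set
r ≐ s = ∀ a b → r a b ≡ s a b

_⋅_ : ∀ {n} → BRel n → BRel n → BRel n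
_⋅_ {n} r s α γ = any (λ β → r α β ∧ s β γ) (allFin n)

_* : ∀ {n} → BRel n → BRel n
(r *) α β = r β α

NonEmpty : ∀ {n} → BRel n → Set
NonEmpty r = ∃ λ a → ∃ λ b → r a b ≡ true

-- c_{rs} at (α,β) : |α r ∩ β s*| = |{γ : (α,γ) ∈ r, (γ,β) ∈ s}|
isect : ∀ {n} → BRel n → BRel n → Fin n → Fin n → ℕ
isect {n} r s α β = sum (map (λ γ → if r α γ ∧ s γ β then 1 else 0) (allFin n))

-- A family of relations indexed by Fin m (the "set" M, listed without
-- repetition, which is automatic from nonemptiness + disjointness).

Fam : ℕ → ℕ → Set
Fam n m = Fin m → BRel n

IsPartialPartition : ∀ {n m} → Fam n m → Set
IsPartialPartition {n} {m} M =
  (∀ i → NonEmpty (M i)) ×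
  (∀ i j (a b : Fin n) → M i a b ≡ true → M j a b ≡ true → i ≡ j)

Covers : ∀ {n m} → Fam n m → Set
Covers {n} {m} M = ∀ (a b : Fin n) → ∃ λ i → M i a b ≡ true

-- 1_Δ is a union of elements of M
DiagUnion : ∀ {n m} → Fam n m → Set
DiagUnion {n} {m} M =
  (∀ (a : Fin n) → ∃ λ i → M i a a ≡ true) ×
  (∀ i → (∀ a b → M i a b ≡ true → a ≡ b) ⊎ (∀ a → M i a a ≡ false))

TransposeClosed : ∀ {n m} → Fam n m → Set
TransposeClosed {n} {m} M = ∀ i → ∃ λ j → M j ≐ (M i *)

Regular : ∀ {n m} → Fam n m → Set
Regular {n} {m} M = ∀ i j k (a b a₂ b₂ : Fin n) →
  M k a b ≡ true → M k a₂ b₂ ≡ true →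
  isect (M i) (M j) a b ≡ isect (M i) (M j) a₂ b₂

IsPCC : ∀ {n m} → Fam n m → Set
IsPCC M = IsPartialPartition M × DiagUnion M × TransposeClosed M × Regular M

IsCC : ∀ {n m} → Fam n m → Set
IsCC M = IsPCC M × Covers M

IsAlgIso : ∀ {n m n' m'} → Fam n m → Fam n' m' → (Fin m → Fin m') → Set
IsAlgIso {n} {m} {n'} {m'} M M' φ =
  FD.Bijective _≡_ _≡_ φ ×
  (∀ i j k (a b : Fin n) (a' b' : Fin n') →
     M k a b ≡ true → M' (φ k) a' b' ≡ true →
     isect (M i) (M j) a b ≡ isect (M' (φ i)) (M' (φ j)) a' b')

-- x is (the index of) a fiber: M x = 1_Λ for some Λ (i.e. M x ⊆ 1_Δ)
IsFiber : ∀ {n m} → Fam n m → Fin m → Set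
IsFiber M x = ∀ a b → M x a b ≡ true → a ≡ b

InFiber : ∀ {n m} → Fam n m → Fin m → Fin n → Set
InFiber M x a = M x a a ≡ true

InBlock : ∀ {n m} → Fam n m → Fin m → Fin m → Fin m → Set
InBlock M x y k = ∀ a b → M k a b ≡ true → InFiber M x a × InFiber M y b

IsMatching : ∀ {n m} → Fam n m → Fin m → Fin m → BRel n → Set
IsMatching {n} M x y r =
  (∀ a b → r a b ≡ true → InFiber M x a × InFiber M y b) ×
  (∀ a → InFiber M x a → ∃ λ b → r a b ≡ true) ×
  (∀ b → InFiber M y b → ∃ λ a → r a b ≡ true) ×
  (∀ a b b' → r a b ≡ true → r a b' ≡ true → b ≡ b') ×
  (∀ a a' b → r a b ≡ true → r a' b ≡ true → a ≡ a')

_∼[_]_ : ∀ {n m} → Fin m → Fam n m → Fin m → Set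
x ∼[ M ] y =
  (∀ a b → InFiber M x a → InFiber M y b →
     ∃ λ k → InBlock M x y k × M k a b ≡ true) ×
  (∀ k → InBlock M x y k → IsMatching M x y (M k))

IsMatchingConfiguration : ∀ {n m} → Fam n m → Set
IsMatchingConfiguration {n} {m} M =
  IsPCC M ×
  (∀ x y → IsFiber M x → IsFiber M y →
     (∃ λ k → InBlock M x y k) →
     (x ∼[ M ] y) ⊎ (x ≡ y × (∀ k → InBlock M x x k → k ≡ x)))

Saturated : ∀ {n m} → Fam n m → Set
Saturated {n} {m} M =
  ∀ (ys : List (Fin m)) → length ys ≤ 4 → All (IsFiber M) ys →
    ∃ λ z → IsFiber M z × All (λ y → z ∼[ M ] y) ys

-- every element of M is a union of elements of T
-- (each T-block meeting M i lies inside M i)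
UnionsOf : ∀ {n m p} → Fam n m → Fam n p → Set
UnionsOf {n} {m} {p} M T =
  ∀ i k (a b : Fin n) → M i a b ≡ true → T k a b ≡ true →
    ∀ c d → T k c d ≡ true → M i c d ≡ true

IsCoherentClosure : ∀ {n m p} → Fam n m → Fam n p → Set
IsCoherentClosure {n} {m} {p} M T =
  IsCC T × UnionsOf M T ×
  (∀ q (S : Fam n q) → IsCC S → UnionsOf M S → UnionsOf T S)

IsNonEmptyProducts : ∀ {n m p} → Fam n m → Fam n p → Set
IsNonEmptyProducts M T =
  (∀ k → ∃ λ i → ∃ λ j → T k ≐ (M i ⋅ M j)) ×
  (∀ i j → NonEmpty (M i ⋅ M j) → ∃ λ k → T k ≐ (M i ⋅ M j))

module Submission where

-- In a matching configuration every basis relation is a matching between two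
-- fibers, so c_{ru}^t ≠ 0 already means M r · M u = M t.  Words in the basis
-- relations are compared by the equivalence generated by these contractions;
-- it is sound for the walks a word describes and, being defined through
-- structure constants, it is carried along φ.  Saturation gives any four
-- points a common hub, through which two words of length two with a common
-- walk become equivalent and words of length four shrink to length two.  Hence
-- the distinct nonempty products form a coherent configuration refining M, so
-- by minimality they are the closure blocks.  Transporting along φ and φ⁻¹
-- gives mutually inverse maps between the closures that preserve composition
-- of (functional) closure blocks, hence all structure constants.

open import Defs
open import Data.Bool using (Bool; true; false; _∧_; not; if_then_else_)
import Data.Bool as Bool
open import Data.Bool.Properties using (¬-not)
open import Data.Bool.ListAction using (any)
open import Data.Empty using (⊥-elim)
open import Data.Fin using (Fin; zero; suc)
open import Data.Fin.Properties using (any?; all?)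
open import Data.List using (List; []; _∷_; _++_; allFin; map; length; lookup; filter; deduplicate; cartesianProduct)
open import Data.List.Membership.Propositional using (_∈_)
open import Data.List.Membership.Propositional.Properties using (∈-allFin; ∈-filter⁺; ∈-cartesianProduct⁺; ∈-lookup)
open import Data.List.Relation.Unary.All as All using ([]; _∷_)
import Data.List.Relation.Unary.All.Properties as All
open import Data.List.Relation.Unary.Any using (here; there)
import Data.List.Relation.Unary.Any as Any
import Data.List.Relation.Unary.Any.Properties as Any
open import Data.List.Relation.Unary.Unique.Propositional using (Unique; _∷_)
open import Data.List.Relation.Unary.Unique.Propositional.Properties using (allFin⁺)
import Data.List.Relation.Unary.Unique.Setoid as SetoidUnique
open import Data.List.Relation.Unary.Unique.DecSetoid.Properties using (deduplicate-!)
open import Data.Nat using (ℕ; suc; _≡ᵇ_; s≤s; z≤n)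
open import Data.Nat.ListAction using (sum)
open import Data.Product using (∃; _×_; _,_; proj₁; proj₂)
open import Data.Sum using (_⊎_; inj₁; inj₂)
open import Function.Bundles using (_⇔_; mk⇔; Equivalence)
open import Function.Consequences.Propositional using (inverseᵇ⇒bijective)
import Function.Definitions as FD
import Function.Properties.Equivalence as ⇔
open import Level using (0ℓ)
open import Relation.Binary.Bundles using (Setoid; DecSetoid)
open import Relation.Binary.Construct.Closure.Equivalence as EqClosure using (EqClosure)
open import Relation.Binary.Core using (Rel)
open import Relation.Binary.PropositionalEquality
open import Relation.Binary.Structures using (IsEquivalence)
open import Relation.Nullary using (Dec; yes; no)

private
  variable
    A : Set
    n : ℕ
    r s r′ s′ : BRel n
    a b c : Fin n

bool-ext : {x y : Bool} → (x ≡ true → y ≡ true) → (y ≡ true → x ≡ true) → x ≡ y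
bool-ext {true}          x⇒y _   = sym (x⇒y refl)
bool-ext {false} {true}  _   y⇒x = y⇒x refl
bool-ext {false} {false} _   _   = refl

∧-elim : {x y : Bool} → x ∧ y ≡ true → x ≡ true × y ≡ true
∧-elim {true} {true} _ = refl , refl

∧-intro : {x y : Bool} → x ≡ true → y ≡ true → x ∧ y ≡ true
∧-intro refl refl = refl

any-elim : (f : A → Bool) (xs : List A) → any f xs ≡ true → ∃ λ x → x ∈ xs × f x ≡ true
any-elim f (x ∷ xs) e with f x in fx
... | true  = x , here refl , fx
... | false = let (y , y∈ , fy) = any-elim f xs e in y , there y∈ , fy

any-intro : (f : A → Bool) {xs : List A} {x : A} → x ∈ xs → f x ≡ true → any f xs ≡ true
any-intro f {x ∷ _} (here refl) fx rewrite fx = refl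
any-intro f {y ∷ _} (there x∈) fx with f y
... | true  = refl
... | false = any-intro f x∈ fx

≐-refl : r ≐ r
≐-refl _ _ = refl

≐-sym : r ≐ s → s ≐ r
≐-sym r≐s a b = sym (r≐s a b)

≐-trans : {t : BRel n} → r ≐ s → s ≐ t → r ≐ t
≐-trans r≐s s≐t a b = trans (r≐s a b) (s≐t a b)

⋅-elim : (r ⋅ s) a c ≡ true → ∃ λ b → r a b ≡ true × s b c ≡ true
⋅-elim e = let (b , _ , rs) = any-elim _ (allFin _) e in b , ∧-elim rs

⋅-intro : r a b ≡ true → s b c ≡ true → (r ⋅ s) a c ≡ true
⋅-intro {b = b} rab sbc = any-intro _ (∈-allFin b) (∧-intro rab sbc)

⋅-cong : r ≐ r′ → s ≐ s′ → (r ⋅ s) ≐ (r′ ⋅ s′)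
⋅-cong {r = r} {r′ = r′} {s = s} {s′ = s′} r≐ s≐ a c = bool-ext
  (λ e → let (b , rab , sbc) = ⋅-elim {r = r} {s = s} e in
         ⋅-intro {r = r′} {s = s′} (trans (sym (r≐ a b)) rab) (trans (sym (s≐ b c)) sbc))
  (λ e → let (b , rab , sbc) = ⋅-elim {r = r′} {s = s′} e in
         ⋅-intro {r = r} {s = s} (trans (r≐ a b) rab) (trans (s≐ b c) sbc))

⋅-transpose : ((r ⋅ s) *) ≐ ((s *) ⋅ (r *))
⋅-transpose {r = r} {s = s} a c = bool-ext
  (λ e → let (b , rcb , sba) = ⋅-elim {r = r} {s = s} e in ⋅-intro {r = s *} {s = r *} sba rcb)
  (λ e → let (b , sba , rcb) = ⋅-elim {r = s *} {s = r *} e in ⋅-intro {r = r} {s = s} rcb sba)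

Functional : BRel n → Set
Functional r = ∀ {a b b′} → r a b ≡ true → r a b′ ≡ true → b ≡ b′

⋅-functional : Functional r → Functional s → Functional (r ⋅ s)
⋅-functional {r = r} {s = s} fr fs e e′ =
  let (_ , rab , sbc) = ⋅-elim {r = r} {s = s} e
      (_ , rab′ , sbc′) = ⋅-elim {r = r} {s = s} e′
  in fs (subst (λ x → s x _ ≡ true) (fr rab rab′) sbc) sbc′

functional-≐ : ∀ {n} {r s : BRel n} → r ≐ s → Functional s → Functional r
functional-≐ r≐s fs rab rab′ = fs (trans (sym (r≐s _ _)) rab) (trans (sym (r≐s _ _)) rab′)

count : (A → Bool) → List A → ℕ
count f xs = sum (map (λ x → if f x then 1 else 0) xs)

any≡count≢0 : (f : A → Bool) (xs : List A) → any f xs ≡ not (count f xs ≡ᵇ 0)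
any≡count≢0 f []       = refl
any≡count≢0 f (x ∷ xs) with f x
... | true  = refl
... | false = any≡count≢0 f xs

count-subsingleton : (f : A → Bool) {xs : List A} → Unique xs →
  (∀ {x y} → f x ≡ true → f y ≡ true → x ≡ y) →
  count f xs ≡ (if any f xs then 1 else 0)
count-subsingleton f {[]} _ _ = refl
count-subsingleton f {x ∷ xs} (x∉xs ∷ unique) atMostOne with f x in fx
... | false = count-subsingleton f unique atMostOne
... | true  = cong suc (trans (count-subsingleton f unique atMostOne) noOther)
  where
  noOther : (if any f xs then 1 else 0) ≡ 0
  noOther with any f xs in e
  ... | false = refl
  ... | true  = let (y , y∈xs , fy) = any-elim f xs e in
                ⊥-elim (All.lookup x∉xs y∈xs (atMostOne fx fy))

⋅≡isect≢0 : ∀ {n} (r s : BRel n) a b → (r ⋅ s) a b ≡ not (isect r s a b ≡ᵇ 0)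
⋅≡isect≢0 {n} r s a b = any≡count≢0 (λ c → r a c ∧ s c b) (allFin n)

isect-functional : ∀ {n} {r : BRel n} (s : BRel n) a b → Functional r →
  isect r s a b ≡ (if (r ⋅ s) a b then 1 else 0)
isect-functional {n} {r} s a b fr =
  count-subsingleton (λ c → r a c ∧ s c b) (allFin⁺ n)
    (λ e e′ → fr (proj₁ (∧-elim e)) (proj₁ (∧-elim e′)))

isect-functional-≡ : ∀ {n n′} {r s : BRel n} {r′ s′ : BRel n′} {a b a′ b′} →
  Functional r → Functional r′ →
  ((r ⋅ s) a b ≡ true → (r′ ⋅ s′) a′ b′ ≡ true) →
  ((r′ ⋅ s′) a′ b′ ≡ true → (r ⋅ s) a b ≡ true) →
  isect r s a b ≡ isect r′ s′ a′ b′
isect-functional-≡ {r = r} {s} {r′} {s′} {a} {b} {a′} {b′} fr fr′ to from = begin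
  isect r s a b                          ≡⟨ isect-functional {r = r} s a b fr ⟩
  (if (r ⋅ s) a b then 1 else 0)         ≡⟨ cong (λ x → if x then 1 else 0) (bool-ext to from) ⟩
  (if (r′ ⋅ s′) a′ b′ then 1 else 0)     ≡⟨ isect-functional {r = r′} s′ a′ b′ fr′ ⟨
  isect r′ s′ a′ b′                      ∎
  where open ≡-Reasoning

isect-≡⇒⋅-≡ : ∀ {n n′} {r s : BRel n} {r′ s′ : BRel n′} {a b a′ b′} →
  isect r s a b ≡ isect r′ s′ a′ b′ → (r ⋅ s) a b ≡ (r′ ⋅ s′) a′ b′
isect-≡⇒⋅-≡ {r = r} {s} {r′} {s′} {a} {b} {a′} {b′} e = begin
  (r ⋅ s) a b                      ≡⟨ ⋅≡isect≢0 r s a b ⟩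
  not (isect r s a b ≡ᵇ 0)         ≡⟨ cong (λ x → not (x ≡ᵇ 0)) e ⟩
  not (isect r′ s′ a′ b′ ≡ᵇ 0)     ≡⟨ ⋅≡isect≢0 r′ s′ a′ b′ ⟨
  (r′ ⋅ s′) a′ b′                  ∎
  where open ≡-Reasoning

regular-⋅ : ∀ {n m} {M : Fam n m} → Regular M → ∀ i j {k a b a₂ b₂} →
  M k a b ≡ true → M k a₂ b₂ ≡ true → (M i ⋅ M j) a b ≡ (M i ⋅ M j) a₂ b₂
regular-⋅ {M = M} reg i j {k} {a} {b} {a₂} {b₂} r r₂ =
  isect-≡⇒⋅-≡ {r = M i} {M j} {M i} {M j} {a} {b} {a₂} {b₂} (reg i j k a b a₂ b₂ r r₂)

functional-regular : ∀ {n m} {F : Fam n m} → (∀ k → Functional (F k)) →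
  (∀ i j {k a b a₂ b₂} → F k a b ≡ true → F k a₂ b₂ ≡ true →
     (F i ⋅ F j) a b ≡ true → (F i ⋅ F j) a₂ b₂ ≡ true) →
  Regular F
functional-regular {F = F} functional move i j k a b a₂ b₂ r r₂ =
  isect-functional-≡ {r = F i} {F j} {F i} {F j} {a} {b} {a₂} {b₂}
    (functional i) (functional i) (move i j r r₂) (move i j r₂ r)

PreservesConstants : ∀ {n m n′ m′} → Fam n m → Fam n′ m′ → (Fin m → Fin m′) → Set
PreservesConstants {n} {m} {n′} {m′} M M′ φ =
  ∀ i j k (a b : Fin n) (a′ b′ : Fin n′) → M k a b ≡ true → M′ (φ k) a′ b′ ≡ true →
    isect (M i) (M j) a b ≡ isect (M′ (φ i)) (M′ (φ j)) a′ b′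

preserves-⋅ : ∀ {n m n′ m′} {M : Fam n m} {M′ : Fam n′ m′} {φ : Fin m → Fin m′} →
  PreservesConstants M M′ φ → ∀ i j {k a b a′ b′} →
  M k a b ≡ true → M′ (φ k) a′ b′ ≡ true → (M i ⋅ M j) a b ≡ (M′ (φ i) ⋅ M′ (φ j)) a′ b′
preserves-⋅ {M = M} {M′} {φ} pres i j {k} {a} {b} {a′} {b′} r r′ =
  isect-≡⇒⋅-≡ {r = M i} {M j} {M′ (φ i)} {M′ (φ j)} {a} {b} {a′} {b′} (pres i j k a b a′ b′ r r′)

module Words {n m : ℕ} (M : Fam n m) where

  Arc : Fin m → Fin n → Fin n → Set
  Arc k a b = M k a b ≡ true

  Path : List (Fin m) → Fin n → Fin n → Set
  Path []      a b = a ≡ b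
  Path (u ∷ w) a b = ∃ λ c → Arc u a c × Path w c b

  path-split : ∀ w {w′ a b} → Path (w ++ w′) a b → ∃ λ c → Path w a c × Path w′ c b
  path-split []      p              = _ , refl , p
  path-split (u ∷ w) (c , arc , p) =
    let (d , p₁ , p₂) = path-split w p in d , (c , arc , p₁) , p₂

  path-join : ∀ w {w′ a c b} → Path w a c → Path w′ c b → Path (w ++ w′) a b
  path-join []      refl           p′ = p′
  path-join (u ∷ w) (d , arc , p) p′ = d , arc , path-join w p p′

  path₂⇒⋅ : ∀ {u v a b} → Path (u ∷ v ∷ []) a b → (M u ⋅ M v) a b ≡ true
  path₂⇒⋅ {u} {v} (c , uac , _ , vcb , refl) = ⋅-intro {r = M u} {s = M v} uac vcb

  ⋅⇒path₂ : ∀ {u v a b} → (M u ⋅ M v) a b ≡ true → Path (u ∷ v ∷ []) a b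
  ⋅⇒path₂ {u} {v} e = let (c , uac , vcb) = ⋅-elim {r = M u} {s = M v} e in c , uac , _ , vcb , refl

  path₄⇒⋅⋅ : ∀ {i j k l a b} → Path (i ∷ j ∷ k ∷ l ∷ []) a b → ((M i ⋅ M j) ⋅ (M k ⋅ M l)) a b ≡ true
  path₄⇒⋅⋅ {i} {j} {k} {l} p =
    let (c , p₁ , p₂) = path-split (i ∷ j ∷ []) p
    in ⋅-intro {r = M i ⋅ M j} {s = M k ⋅ M l} (path₂⇒⋅ p₁) (path₂⇒⋅ p₂)

  ⋅⋅⇒path₄ : ∀ {i j k l a b} → ((M i ⋅ M j) ⋅ (M k ⋅ M l)) a b ≡ true → Path (i ∷ j ∷ k ∷ l ∷ []) a b
  ⋅⋅⇒path₄ {i} {j} {k} {l} e =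
    let (c , ij , kl) = ⋅-elim {r = M i ⋅ M j} {s = M k ⋅ M l} e
    in path-join (i ∷ j ∷ []) (⋅⇒path₂ ij) (⋅⇒path₂ kl)

  -- Step r u t: the block t meets M r · M u, i.e. c_{ru}^t ≠ 0.
  Step : Fin m → Fin m → Fin m → Set
  Step r u t = ∃ λ a → ∃ λ b → Arc t a b × (M r ⋅ M u) a b ≡ true

  data Contract : Rel (List (Fin m)) 0ℓ where
    front  : ∀ {r u t w} → Step r u t → Contract (r ∷ u ∷ w) (t ∷ w)
    behind : ∀ x {w w′} → Contract w w′ → Contract (x ∷ w) (x ∷ w′)

  infix 4 _≈_
  _≈_ : Rel (List (Fin m)) 0ℓ
  _≈_ = EqClosure Contract

  ≈-setoid : Setoid 0ℓ 0ℓ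
  ≈-setoid = EqClosure.setoid Contract

  contract : ∀ {r u t w} → Step r u t → (r ∷ u ∷ w) ≈ (t ∷ w)
  contract s = EqClosure.return (front s)

  ≈-cons : ∀ x {w w′} → w ≈ w′ → (x ∷ w) ≈ (x ∷ w′)
  ≈-cons x = EqClosure.gmap (x ∷_) (behind x)

  SamePaths : Rel (List (Fin m)) 0ℓ
  SamePaths w w′ = ∀ a b → Path w a b ⇔ Path w′ a b

  samePaths-isEquivalence : IsEquivalence SamePaths
  samePaths-isEquivalence = record
    { refl  = λ _ _ → ⇔.refl
    ; sym   = λ e a b → ⇔.sym (e a b)
    ; trans = λ e f a b → ⇔.trans (e a b) (f a b)
    }

module MatchingConfiguration {n m : ℕ} (M : Fam n m) (mc : IsMatchingConfiguration M) where

  open Words M public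

  private
    pcc : IsPCC M
    pcc = proj₁ mc
    du : DiagUnion M
    du = proj₁ (proj₂ pcc)
    reg : Regular M
    reg = proj₂ (proj₂ (proj₂ pcc))

  block-nonempty : ∀ k → NonEmpty (M k)
  block-nonempty = proj₁ (proj₁ pcc)

  disjoint : ∀ {i j a b} → Arc i a b → Arc j a b → i ≡ j
  disjoint {i} {j} {a} {b} = proj₂ (proj₁ pcc) i j a b

  transpose-closed : TransposeClosed M
  transpose-closed = proj₁ (proj₂ (proj₂ pcc))

  fiber : Fin n → Fin m
  fiber a = proj₁ (proj₁ du a)

  fiber-loop : ∀ a → Arc (fiber a) a a
  fiber-loop a = proj₂ (proj₁ du a)

  fiber-unique : ∀ {x a} → Arc x a a → fiber a ≡ x
  fiber-unique = disjoint (fiber-loop _)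

  fiber-isFiber : ∀ a → IsFiber M (fiber a)
  fiber-isFiber a with proj₂ du (fiber a)
  ... | inj₁ diagonal  = diagonal
  ... | inj₂ loopless with trans (sym (fiber-loop a)) (loopless a)
  ...   | ()

  in-fiber : ∀ {x a} → fiber a ≡ x → InFiber M x a
  in-fiber {a = a} refl = fiber-loop a

  -- Regularity forces all arcs of a block to run between the same two fibers.
  block-between-fibers : ∀ {k a b} → Arc k a b → InBlock M (fiber a) (fiber b) k
  block-between-fibers {k} {a} {b} r a₂ b₂ r₂ = source , target
    where
    source : InFiber M (fiber a) a₂
    source =
      let at-ab = ⋅-intro {r = M (fiber a)} {s = M k} (fiber-loop a) r
          at-a₂b₂ = trans (sym (regular-⋅ reg (fiber a) k r r₂)) at-ab
          (c , loop , _) = ⋅-elim {r = M (fiber a)} {s = M k} at-a₂b₂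
      in subst (λ x → Arc (fiber a) a₂ x) (sym (fiber-isFiber a a₂ c loop)) loop
    target : InFiber M (fiber b) b₂
    target =
      let at-ab = ⋅-intro {r = M k} {s = M (fiber b)} r (fiber-loop b)
          at-a₂b₂ = trans (sym (regular-⋅ reg k (fiber b) r r₂)) at-ab
          (c , _ , loop) = ⋅-elim {r = M k} {s = M (fiber b)} at-a₂b₂
      in subst (λ x → Arc (fiber b) x b₂) (fiber-isFiber b c b₂ loop) loop

  fiber-matching : ∀ {x} → IsFiber M x → IsMatching M x x (M x)
  fiber-matching {x} diagonal =
    (λ a b r → loop-at-source r , subst (λ c → Arc x c b) (diagonal a b r) r) ,
    (λ a inx → a , inx) ,
    (λ b inx → b , inx) ,
    (λ a b b′ r r′ → trans (sym (diagonal a b r)) (diagonal a b′ r′)) ,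
    (λ a a′ b r r′ → trans (diagonal a b r) (sym (diagonal a′ b r′)))
    where
    loop-at-source : ∀ {a b} → Arc x a b → Arc x a a
    loop-at-source {a} {b} r = subst (Arc x a) (sym (diagonal a b r)) r

  block-matching : ∀ {k a b} → Arc k a b → IsMatching M (fiber a) (fiber b) (M k)
  block-matching {k} {a} {b} r
    with proj₂ mc (fiber a) (fiber b) (fiber-isFiber a) (fiber-isFiber b) (k , block-between-fibers r)
  ... | inj₁ (_ , matchings) = matchings k (block-between-fibers r)
  ... | inj₂ (sameFiber , onlyFiber) =
    subst₂ (λ y l → IsMatching M (fiber a) y (M l)) sameFiber
      (sym (onlyFiber k (subst (λ y → InBlock M (fiber a) y k) (sym sameFiber) (block-between-fibers r))))
      (fiber-matching (fiber-isFiber a))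

  block-functional : ∀ k → Functional (M k)
  block-functional k r r′ = proj₁ (proj₂ (proj₂ (proj₂ (block-matching r)))) _ _ _ r r′

  source-fiber : ∀ {k a b a′ b′} → Arc k a b → Arc k a′ b′ → fiber a′ ≡ fiber a
  source-fiber r r′ = fiber-unique (proj₁ (proj₁ (block-matching r) _ _ r′))

  target-fiber : ∀ {k a b a′ b′} → Arc k a b → Arc k a′ b′ → fiber b′ ≡ fiber b
  target-fiber r r′ = fiber-unique (proj₂ (proj₁ (block-matching r) _ _ r′))

  total : ∀ {k a b a′} → Arc k a b → fiber a′ ≡ fiber a → ∃ λ b′ → Arc k a′ b′
  total r e = proj₁ (proj₂ (block-matching r)) _ (in-fiber e)

  step-product : ∀ {r u t} → Step r u t → (M r ⋅ M u) ≐ M t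
  step-product {r} {u} {t} (a₀ , b₀ , t₀ , ru₀) a b = bool-ext ru⇒t t⇒ru
    where
    t⇒ru : ∀ {x y} → Arc t x y → (M r ⋅ M u) x y ≡ true
    t⇒ru tab = trans (sym (regular-⋅ reg r u t₀ tab)) ru₀
    -- t is total on the fiber of a, giving (a,b′) ∈ t ⊆ r · u, and since
    -- r and u are functional, b′ = b.
    ru⇒t : (M r ⋅ M u) a b ≡ true → Arc t a b
    ru⇒t e =
      let (c , rac , ucb) = ⋅-elim {r = M r} {s = M u} e
          (c₀ , ra₀c₀ , _) = ⋅-elim {r = M r} {s = M u} ru₀
          (b′ , tab′) = total t₀ (source-fiber ra₀c₀ rac)
          (c′ , rac′ , ucb′) = ⋅-elim {r = M r} {s = M u} (t⇒ru tab′)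
          c≡c′ = block-functional r rac rac′
          b≡b′ = block-functional u (subst (λ x → Arc u x b) c≡c′ ucb) ucb′
      in subst (Arc t a) (sym b≡b′) tab′

  step-arc : ∀ {r u t a c b} → Arc r a c → Arc u c b → Arc t a b → Step r u t
  step-arc {r} {u} rac ucb tab = _ , _ , tab , ⋅-intro {r = M r} {s = M u} rac ucb

  step-fiber-left : ∀ {u a c} → Arc u a c → Step (fiber a) u u
  step-fiber-left {a = a} uac = step-arc (fiber-loop a) uac uac

  step-fiber-right : ∀ {u a c} → Arc u a c → Step u (fiber c) u
  step-fiber-right {c = c} uac = step-arc uac (fiber-loop c) uac

  step-return : ∀ {s r a e} → Arc s a e → Arc r e a → Step s r (fiber a)
  step-return {a = a} sae rea = step-arc sae rea (fiber-loop a)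

  contract-sound : ∀ {w w′} → Contract w w′ → SamePaths w w′
  contract-sound (front {r} {u} {t} s) a b = mk⇔
    (λ (c , rac , d , ucd , p) →
       d , trans (sym (step-product s a d)) (⋅-intro {r = M r} {s = M u} rac ucd) , p)
    (λ (d , tad , p) → let (c , rac , ucd) = ⋅-elim {r = M r} {s = M u} (trans (step-product s a d) tad)
                       in c , rac , d , ucd , p)
  contract-sound (behind x c) a b = mk⇔
    (λ (d , arc , p) → d , arc , Equivalence.to (contract-sound c d b) p)
    (λ (d , arc , p) → d , arc , Equivalence.from (contract-sound c d b) p)

  sound : ∀ {w w′} → w ≈ w′ → SamePaths w w′
  sound = EqClosure.fold samePaths-isEquivalence contract-sound

  ≈⇒≐ : ∀ {u v u′ v′} → (u ∷ v ∷ []) ≈ (u′ ∷ v′ ∷ []) → (M u ⋅ M v) ≐ (M u′ ⋅ M v′)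
  ≈⇒≐ eq a b = bool-ext
    (λ e → path₂⇒⋅ (Equivalence.to (sound eq a b) (⋅⇒path₂ e)))
    (λ e → path₂⇒⋅ (Equivalence.from (sound eq a b) (⋅⇒path₂ e)))

  composable : ∀ {u v y} → Step u y u → Step y v v → NonEmpty (M u ⋅ M v)
  composable {u} {v} {y} uy vy =
    let (a , c , uac) = block-nonempty u
        (_ , _ , yc′c) = ⋅-elim {r = M u} {s = M y} (trans (step-product uy a c) uac)
        (d , b , vdb) = block-nonempty v
        (_ , ydd′ , vd′b) = ⋅-elim {r = M y} {s = M v} (trans (step-product vy d b) vdb)
        (b′ , vcb′) = total vd′b (target-fiber ydd′ yc′c)
    in a , b′ , ⋅-intro {r = M u} {s = M v} uac vcb′

-- Consequences of saturation: words of length two to four through a common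
-- pair of points can be compared by routing them through a common hub point.
module SaturatedMatchingConfiguration {n m : ℕ} (M : Fam n m) (mc : IsMatchingConfiguration M)
                                      (sat : Saturated M) where

  open MatchingConfiguration M mc public
  open import Relation.Binary.Reasoning.Setoid ≈-setoid

  Joined : Fin n → Fin n → Set
  Joined e p = (∃ λ k → Arc k e p) × (∃ λ k → Arc k p e)

  hub : ∀ p₁ p₂ p₃ p₄ → ∃ λ e → Joined e p₁ × Joined e p₂ × Joined e p₃ × Joined e p₄
  hub p₁ p₂ p₃ p₄
    with sat (fiber p₁ ∷ fiber p₂ ∷ fiber p₃ ∷ fiber p₄ ∷ []) (s≤s (s≤s (s≤s (s≤s z≤n))))
             (fiber-isFiber p₁ ∷ fiber-isFiber p₂ ∷ fiber-isFiber p₃ ∷ fiber-isFiber p₄ ∷ [])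
  ... | z , diagonal , z∼p₁ ∷ z∼p₂ ∷ z∼p₃ ∷ z∼p₄ ∷ [] =
    e , joined z∼p₁ , joined z∼p₂ , joined z∼p₃ , joined z∼p₄
    where
    e : Fin n
    e = proj₁ (block-nonempty z)
    e∈z : InFiber M z e
    e∈z = let (e′ , zee′) = proj₂ (block-nonempty z) in
          subst (Arc z e) (sym (diagonal e e′ zee′)) zee′
    joined : ∀ {p} → z ∼[ M ] fiber p → Joined e p
    joined {p} z∼p =
      let (k , _ , kep) = proj₁ z∼p e p e∈z (fiber-loop p)
          (j , j≐k*) = transpose-closed k
      in (k , kep) , (j , trans (j≐k* p e) kep)

  detour : ∀ {s r u w a e c} → Arc s a e → Arc r e a → Arc u a c → (u ∷ w) ≈ (s ∷ r ∷ u ∷ w)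
  detour {s} {r} {u} {w} sae rea uac = begin
    u ∷ w                 ≈⟨ contract (step-fiber-left uac) ⟨
    fiber _ ∷ u ∷ w       ≈⟨ contract (step-return sae rea) ⟨
    s ∷ r ∷ u ∷ w         ∎

  absorb : ∀ {t u w e c d} → Arc t e c → Arc u c d → (∃ λ k → Arc k e d) →
    ∃ λ t′ → (t ∷ u ∷ w) ≈ (t′ ∷ w) × Arc t′ e d
  absorb tec ucd (t′ , t′ed) = t′ , contract (step-arc tec ucd t′ed) , t′ed

  -- Routing a word u v through a hub e joined to its intermediate point and
  -- its end point: it becomes s β for the fixed first arc s : a → e.
  funnel : ∀ {s α u v w a e c b} → Arc s a e → Arc α e a → Joined e c → Joined e b →
    Arc u a c → Arc v c b → ∃ λ β → (u ∷ v ∷ w) ≈ (s ∷ β ∷ w) × Arc β e b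
  funnel {s} {α} {u} {v} {w} sae αea ec eb uac vcb =
    let (r , αu≈r , rec) = absorb {w = v ∷ w} αea uac (proj₁ ec)
        (β , rv≈β , βeb) = absorb {w = w} rec vcb (proj₁ eb)
    in β , (begin
         u ∷ v ∷ w           ≈⟨ detour sae αea uac ⟩
         s ∷ α ∷ u ∷ v ∷ w   ≈⟨ ≈-cons s αu≈r ⟩
         s ∷ r ∷ v ∷ w       ≈⟨ ≈-cons s rv≈β ⟩
         s ∷ β ∷ w           ∎) , βeb

  -- Two words of length two having walks between the same two points are
  -- equivalent: route both through a hub joined to all four points involved.
  two-words : ∀ {u v u′ v′ a b} → Path (u ∷ v ∷ []) a b → Path (u′ ∷ v′ ∷ []) a b →
    (u ∷ v ∷ []) ≈ (u′ ∷ v′ ∷ [])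
  two-words {u} {v} {u′} {v′} (c , uac , _ , vcb , refl) (c′ , u′ac′ , _ , v′c′b , refl) =
    let (e , ea , ec , ec′ , eb) = hub _ c c′ _
        (α , αea) = proj₁ ea
        (s , sae) = proj₂ ea
        (β , uv≈sβ , βeb) = funnel {w = []} sae αea ec eb uac vcb
        (β′ , u′v′≈sβ′ , β′eb) = funnel {w = []} sae αea ec′ eb u′ac′ v′c′b
    in begin
      u ∷ v ∷ []     ≈⟨ uv≈sβ ⟩
      s ∷ β ∷ []     ≡⟨ cong (λ x → s ∷ x ∷ []) (disjoint βeb β′eb) ⟩
      s ∷ β′ ∷ []    ≈⟨ u′v′≈sβ′ ⟨
      u′ ∷ v′ ∷ []   ∎

  three-words : ∀ {r s t a b} → Path (r ∷ s ∷ t ∷ []) a b →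
    ∃ λ u → ∃ λ v → (r ∷ s ∷ t ∷ []) ≈ (u ∷ v ∷ [])
  three-words {r} {s} {t} (c₁ , rac₁ , c₂ , sc₁c₂ , _ , tc₂b , refl) =
    let (e , ea , ec₁ , ec₂ , eb) = hub _ c₁ c₂ _
        (α , αea) = proj₁ ea
        (s₀ , s₀ae) = proj₂ ea
        (β , rst≈s₀βt , βec₂) = funnel {w = t ∷ []} s₀ae αea ec₁ ec₂ rac₁ sc₁c₂
        (γ , βt≈γ , _) = absorb {w = []} βec₂ tc₂b (proj₁ eb)
    in s₀ , γ , (begin
      r ∷ s ∷ t ∷ []    ≈⟨ rst≈s₀βt ⟩
      s₀ ∷ β ∷ t ∷ []   ≈⟨ ≈-cons s₀ βt≈γ ⟩
      s₀ ∷ γ ∷ []       ∎)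

  four-words : ∀ {u₁ u₂ u₃ u₄ a b} → Path (u₁ ∷ u₂ ∷ u₃ ∷ u₄ ∷ []) a b →
    ∃ λ u → ∃ λ v → (u₁ ∷ u₂ ∷ u₃ ∷ u₄ ∷ []) ≈ (u ∷ v ∷ [])
  four-words {u₁} {u₂} {u₃} {u₄} {b = b} (c , u₁ac , p) =
    let (s , t , tail≈st) = three-words p
        p′ = Equivalence.to (sound tail≈st c b) p
        (u , v , u₁st≈uv) = three-words (c , u₁ac , p′)
    in u , v , (begin
      u₁ ∷ u₂ ∷ u₃ ∷ u₄ ∷ []   ≈⟨ ≈-cons u₁ tail≈st ⟩
      u₁ ∷ s ∷ t ∷ []          ≈⟨ u₁st≈uv ⟩
      u ∷ v ∷ []               ∎)

  two-four-words : ∀ {u v u₁ u₂ u₃ u₄ a b} → Path (u ∷ v ∷ []) a b →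
    Path (u₁ ∷ u₂ ∷ u₃ ∷ u₄ ∷ []) a b → (u ∷ v ∷ []) ≈ (u₁ ∷ u₂ ∷ u₃ ∷ u₄ ∷ [])
  two-four-words {u} {v} {u₁} {u₂} {u₃} {u₄} {a} {b} p₂ p₄ =
    let (u′ , v′ , w≈u′v′) = four-words p₄
    in begin
      u ∷ v ∷ []                 ≈⟨ two-words p₂ (Equivalence.to (sound w≈u′v′ a b) p₄) ⟩
      u′ ∷ v′ ∷ []               ≈⟨ w≈u′v′ ⟨
      u₁ ∷ u₂ ∷ u₃ ∷ u₄ ∷ []     ∎

  shared-product : ∀ {u v u′ v′ a b} → (M u ⋅ M v) a b ≡ true → (M u′ ⋅ M v′) a b ≡ true →
    (M u ⋅ M v) ≐ (M u′ ⋅ M v′)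
  shared-product e e′ = ≈⇒≐ (two-words (⋅⇒path₂ e) (⋅⇒path₂ e′))

  product-in-product : ∀ {u v i j k l a b a₂ b₂} →
    (M u ⋅ M v) a b ≡ true → (M u ⋅ M v) a₂ b₂ ≡ true →
    ((M i ⋅ M j) ⋅ (M k ⋅ M l)) a b ≡ true → ((M i ⋅ M j) ⋅ (M k ⋅ M l)) a₂ b₂ ≡ true
  product-in-product {a₂ = a₂} {b₂} e e₂ e₄ =
    path₄⇒⋅⋅ (Equivalence.to (sound (two-four-words (⋅⇒path₂ e) (⋅⋅⇒path₄ e₄)) a₂ b₂) (⋅⇒path₂ e₂))

unique-lookup : ∀ {c ℓ} (S : Setoid c ℓ) {xs : List (Setoid.Carrier S)} → SetoidUnique.Unique S xs →
  ∀ i j → Setoid._≈_ S (lookup xs i) (lookup xs j) → i ≡ j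
unique-lookup S (_ ∷ _) zero zero _ = refl
unique-lookup S (x≉xs ∷ _) zero (suc j) x≈ = ⊥-elim (All.lookup x≉xs (∈-lookup j) x≈)
unique-lookup S (x≉xs ∷ _) (suc i) zero ≈x = ⊥-elim (All.lookup x≉xs (∈-lookup i) (Setoid.sym S ≈x))
unique-lookup S (_ ∷ unique) (suc i) (suc j) eq = cong suc (unique-lookup S unique i j eq)

module ProductConfiguration {n m : ℕ} (M : Fam n m) (mc : IsMatchingConfiguration M)
                            (sat : Saturated M) where

  open SaturatedMatchingConfiguration M mc sat

  product : Fin m × Fin m → BRel n
  product x = M (proj₁ x) ⋅ M (proj₂ x)

  -- Pairs of basis relations, identified when their products are equal;
  -- this is decidable since relations on a finite set can be compared.
  pairs-by-product : DecSetoid 0ℓ 0ℓ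
  pairs-by-product = record
    { Carrier = Fin m × Fin m
    ; _≈_ = λ x y → product x ≐ product y
    ; isDecEquivalence = record
      { isEquivalence = record { refl = ≐-refl ; sym = ≐-sym ; trans = ≐-trans }
      ; _≟_ = λ x y → all? (λ a → all? (λ b → product x a b Bool.≟ product y a b))
      }
    }

  open DecSetoid pairs-by-product using (_≟_) renaming (setoid to pairs-by-product-setoid)

  nonempty? : ∀ x → Dec (NonEmpty (product x))
  nonempty? x = any? (λ a → any? (λ b → product x a b Bool.≟ true))

  all-pairs nonempty-pairs : List (Fin m × Fin m)
  all-pairs = cartesianProduct (allFin m) (allFin m)
  nonempty-pairs = filter nonempty? all-pairs

  products : List (Fin m × Fin m)
  products = deduplicate _≟_ nonempty-pairs

  P : Fam n (length products)
  P l = product (lookup products l)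

  P-nonempty : ∀ l → NonEmpty (P l)
  P-nonempty l = All.lookup (All.deduplicate⁺ _≟_ (All.all-filter nonempty? all-pairs)) (∈-lookup l)

  P-distinct : ∀ {l l′} → P l ≐ P l′ → l ≡ l′
  P-distinct = unique-lookup pairs-by-product-setoid (deduplicate-! pairs-by-product nonempty-pairs) _ _

  P-complete : ∀ {i j} → NonEmpty (M i ⋅ M j) → ∃ λ l → (M i ⋅ M j) ≐ P l
  P-complete {i} {j} nonempty =
    let listed = ∈-filter⁺ nonempty? (∈-cartesianProduct⁺ (∈-allFin i) (∈-allFin j)) nonempty
        kept = Any.deduplicate⁺ _≟_ (λ y≈x ij≈x → ≐-trans ij≈x (≐-sym y≈x))
                 (Any.map (λ { refl → ≐-refl }) listed)
    in Any.index kept , Any.lookup-index kept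

  -- The axioms of a coherent configuration for P.  Blocks sharing a point are
  -- equal products, hence the same block.
  P-functional : ∀ l → Functional (P l)
  P-functional l = ⋅-functional {r = M u} {s = M v} (block-functional u) (block-functional v)
    where
    u v : Fin m
    u = proj₁ (lookup products l)
    v = proj₂ (lookup products l)

  P-partition : IsPartialPartition P
  P-partition = P-nonempty , λ l l′ a b e e′ → P-distinct (shared-product e e′)

  fiber-square : ∀ c {a b} → (M (fiber c) ⋅ M (fiber c)) a b ≡ true → a ≡ b
  fiber-square c e =
    let (d , x , y) = ⋅-elim {r = M (fiber c)} {s = M (fiber c)} e
    in trans (fiber-isFiber c _ d x) (fiber-isFiber c d _ y)

  -- A block containing a loop at c is the product of the fiber of c with
  -- itself, hence lies on the diagonal.
  P-diagonal : DiagUnion P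
  P-diagonal = on-diagonal , λ l → diagonal-or-loopless l (any? (λ c → P l c c Bool.≟ true))
    where
    loop² : ∀ a → (M (fiber a) ⋅ M (fiber a)) a a ≡ true
    loop² a = ⋅-intro {r = M (fiber a)} {s = M (fiber a)} (fiber-loop a) (fiber-loop a)
    on-diagonal : ∀ a → ∃ λ l → P l a a ≡ true
    on-diagonal a = let (l , eq) = P-complete (a , a , loop² a) in l , trans (sym (eq a a)) (loop² a)
    diagonal-or-loopless : ∀ l → Dec (∃ λ c → P l c c ≡ true) →
      (∀ a b → P l a b ≡ true → a ≡ b) ⊎ (∀ a → P l a a ≡ false)
    diagonal-or-loopless l (yes (c , e)) =
      inj₁ λ a b e′ → fiber-square c (trans (sym (shared-product e (loop² c) a b)) e′)
    diagonal-or-loopless l (no noLoop) = inj₂ λ a → ¬-not λ e → noLoop (a , e)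

  -- (M u · M v)* = M v* · M u* is again a nonempty product.
  P-transpose : TransposeClosed P
  P-transpose l =
    let (u , v) = lookup products l
        (u* , u*≐) = transpose-closed u
        (v* , v*≐) = transpose-closed v
        v*u*≐ = ≐-trans (⋅-cong v*≐ u*≐) (≐-sym (⋅-transpose {r = M u} {s = M v}))
        (a , b , e) = P-nonempty l
        (l′ , eq) = P-complete (b , a , trans (v*u*≐ b a) e)
    in l′ , ≐-trans (≐-sym eq) v*u*≐

  -- Membership of a pair in P i · P j, a product of length four, depends only
  -- on the block of the pair.
  P-regular : Regular P
  P-regular = functional-regular P-functional (λ i j → product-in-product)

  -- Every pair (a,b) is covered: route it through a hub.
  P-covers : Covers P
  P-covers a b =
    let (e , ea , eb , _ , _) = hub a b a b
        (s , sae) = proj₂ ea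
        (t , teb) = proj₁ eb
        st = ⋅-intro {r = M s} {s = M t} sae teb
        (l , eq) = P-complete (a , b , st)
    in l , trans (sym (eq a b)) st

  P-coherent : IsCC P
  P-coherent = (P-partition , P-diagonal , P-transpose , P-regular) , P-covers

  -- A block meeting M i is the product M i · M y with y the fiber of the
  -- targets, which equals M i.
  M-unions-of-P : UnionsOf M P
  M-unions-of-P i l a b iab e c d e′ =
    let i≐i·fb = ≐-sym (step-product (step-fiber-right iab))
        ifb = trans (sym (i≐i·fb a b)) iab
    in trans (i≐i·fb c d) (trans (shared-product ifb e c d) e′)

block-in-product : ∀ {n m p} {M : Fam n m} {T : Fam n p} → IsCC T → UnionsOf M T →
  ∀ i j {k a b c d} → T k a b ≡ true → (M i ⋅ M j) a b ≡ true → T k c d ≡ true →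
  (M i ⋅ M j) c d ≡ true
block-in-product {M = M} {T} ((_ , _ , _ , reg) , covers) unions i j {k} {a} {b} {c} {d} tab e tcd =
  let (e′ , iae′ , je′b) = ⋅-elim {r = M i} {s = M j} e
      (k₁ , t₁ae′) = covers a e′
      (k₂ , t₂e′b) = covers e′ b
      t₁t₂ = trans (sym (regular-⋅ reg k₁ k₂ tab tcd)) (⋅-intro {r = T k₁} {s = T k₂} t₁ae′ t₂e′b)
      (γ , t₁cγ , t₂γd) = ⋅-elim {r = T k₁} {s = T k₂} t₁t₂
  in ⋅-intro {r = M i} {s = M j} (unions i k₁ a e′ iae′ t₁ae′ c γ t₁cγ) (unions j k₂ e′ b je′b t₂e′b γ d t₂γd)

module Closure {n m p : ℕ} (M : Fam n m) (mc : IsMatchingConfiguration M) (sat : Saturated M)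
               (T : Fam n p) (cl : IsCoherentClosure M T) where

  open SaturatedMatchingConfiguration M mc sat public
  open ProductConfiguration M mc sat using (P; P-coherent; P-covers; P-complete; M-unions-of-P)

  private
    T-coherent : IsCC T
    T-coherent = proj₁ cl
    M-unions-of-T : UnionsOf M T
    M-unions-of-T = proj₁ (proj₂ cl)
    -- minimality of the closure, applied to the product configuration
    T-unions-of-P : UnionsOf T P
    T-unions-of-P = proj₂ (proj₂ cl) _ P P-coherent M-unions-of-P

  T-nonempty : ∀ k → NonEmpty (T k)
  T-nonempty = proj₁ (proj₁ (proj₁ T-coherent))

  T≐P : ∀ {k l a b} → T k a b ≡ true → P l a b ≡ true → T k ≐ P l
  T≐P {k} {l} {a} {b} tab pab c d = bool-ext
    (λ tcd → block-in-product T-coherent M-unions-of-T _ _ tab pab tcd)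
    (λ pcd → T-unions-of-P k l a b tab pab c d pcd)

  -- T = (M · M)^#: every block is a product, and every nonempty product
  -- meets, hence equals, some block.
  closure-products : IsNonEmptyProducts M T
  closure-products = every-block-a-product , every-product-a-block
    where
    every-block-a-product : ∀ k → ∃ λ i → ∃ λ j → T k ≐ (M i ⋅ M j)
    every-block-a-product k =
      let (a , b , tab) = T-nonempty k
          (l , pab) = P-covers a b
      in _ , _ , T≐P tab pab
    every-product-a-block : ∀ i j → NonEmpty (M i ⋅ M j) → ∃ λ k → T k ≐ (M i ⋅ M j)
    every-product-a-block i j (a , b , e) =
      let (k , tab) = proj₂ T-coherent a b
          (l , eq) = P-complete (a , b , e)
      in k , ≐-trans (T≐P tab (trans (sym (eq a b)) e)) (≐-sym eq)

  left right : Fin p → Fin m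
  left k = proj₁ (proj₁ closure-products k)
  right k = proj₁ (proj₂ (proj₁ closure-products k))

  T-factor : ∀ k → T k ≐ (M (left k) ⋅ M (right k))
  T-factor k = proj₂ (proj₂ (proj₁ closure-products k))

  T⇒path : ∀ {k a b} → T k a b ≡ true → Path (left k ∷ right k ∷ []) a b
  T⇒path {k} {a} {b} tab = ⋅⇒path₂ (trans (sym (T-factor k a b)) tab)

  T-functional : ∀ k → Functional (T k)
  T-functional k = functional-≐ (T-factor k)
    (⋅-functional {r = M (left k)} {s = M (right k)} (block-functional (left k)) (block-functional (right k)))

  T-injective : ∀ {k k′} → T k ≐ T k′ → k ≡ k′
  T-injective {k} {k′} eq =
    let (a , b , tab) = T-nonempty k
    in proj₂ (proj₁ (proj₁ T-coherent)) k k′ a b tab (trans (sym (eq a b)) tab)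

module WordTransfer {n m n′ m′ : ℕ} (M : Fam n m) (M′ : Fam n′ m′) (φ : Fin m → Fin m′)
                    (pres : PreservesConstants M M′ φ) (nonempty′ : ∀ k → NonEmpty (M′ k)) where

  module W = Words M
  module W′ = Words M′

  -- c_{ru}^t ≠ 0 is witnessed at any arc of φ t.
  step-transfer : ∀ {r u t} → W.Step r u t → W′.Step (φ r) (φ u) (φ t)
  step-transfer {r} {u} {t} (a , b , tab , e) =
    let (a′ , b′ , t′a′b′) = nonempty′ (φ t)
    in a′ , b′ , t′a′b′ , trans (sym (preserves-⋅ {M = M} {M′} {φ} pres r u tab t′a′b′)) e

  contract-transfer : ∀ {w w′} → W.Contract w w′ → W′.Contract (map φ w) (map φ w′)
  contract-transfer (W.front s)    = W′.front (step-transfer s)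
  contract-transfer (W.behind x c) = W′.behind (φ x) (contract-transfer c)

  ≈-transfer : ∀ {w w′} → w W.≈ w′ → map φ w W′.≈ map φ w′
  ≈-transfer = EqClosure.gmap (map φ) contract-transfer

module ClosureMap {n m n′ m′ p p′ : ℕ} (M : Fam n m) (M′ : Fam n′ m′) (T : Fam n p) (T′ : Fam n′ p′)
                  (mc : IsMatchingConfiguration M) (sat : Saturated M)
                  (mc′ : IsMatchingConfiguration M′) (sat′ : Saturated M′)
                  (cl : IsCoherentClosure M T) (cl′ : IsCoherentClosure M′ T′)
                  (φ : Fin m → Fin m′) (pres : PreservesConstants M M′ φ) where

  module C = Closure M mc sat T cl
  module C′ = Closure M′ mc′ sat′ T′ cl′
  open WordTransfer M M′ φ pres C′.block-nonempty

  composable-transfer : ∀ {u v} → NonEmpty (M u ⋅ M v) → NonEmpty (M′ (φ u) ⋅ M′ (φ v))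
  composable-transfer {u} {v} (a , b , e) =
    let (c , uac , vcb) = ⋅-elim {r = M u} {s = M v} e
    in C′.composable (step-transfer (C.step-fiber-right uac)) (step-transfer (C.step-fiber-left vcb))

  shared-product-transfer : ∀ {u v u′ v′ a b} → (M u ⋅ M v) a b ≡ true → (M u′ ⋅ M v′) a b ≡ true →
    (M′ (φ u) ⋅ M′ (φ v)) ≐ (M′ (φ u′) ⋅ M′ (φ v′))
  shared-product-transfer e e′ = C′.≈⇒≐ (≈-transfer (C.two-words (C.⋅⇒path₂ e) (C.⋅⇒path₂ e′)))

  -- M′ (φ u) · M′ (φ v) is nonempty for the factorisation T k = M u · M v,
  -- so it is a block of T′.
  private
    image : ∀ k → ∃ λ k′ → T′ k′ ≐ (M′ (φ (C.left k)) ⋅ M′ (φ (C.right k)))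
    image k =
      let (a , b , tab) = C.T-nonempty k
      in proj₂ C′.closure-products _ _ (composable-transfer (a , b , trans (sym (C.T-factor k a b)) tab))

  -- ψ is used only through ψ-factor; keeping it opaque also stops the type
  -- checker from unfolding its construction when comparing images.
  opaque
    ψ : Fin p → Fin p′
    ψ k = proj₁ (image k)

    ψ-factor : ∀ k → T′ (ψ k) ≐ (M′ (φ (C.left k)) ⋅ M′ (φ (C.right k)))
    ψ-factor k = proj₂ (image k)

  ψ-product : ∀ i j k → T k ≐ (M i ⋅ M j) → T′ (ψ k) ≐ (M′ (φ i) ⋅ M′ (φ j))
  ψ-product i j k eq =
    let (a , b , tab) = C.T-nonempty k
    in ≐-trans (ψ-factor k)
         (shared-product-transfer (trans (sym (C.T-factor k a b)) tab) (trans (sym (eq a b)) tab))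

  -- ψ extends φ: a basis relation M i is the product M i · M y with the
  -- fiber y of its targets, and this factorisation is transported by φ.
  ψ-basis : ∀ i k → T k ≐ M i → T′ (ψ k) ≐ M′ (φ i)
  ψ-basis i k eq =
    let (a , b , tab) = C.T-nonempty k
        iab = trans (sym (eq a b)) tab
        y = C.fiber b
    in ≐-trans (ψ-product i y k (≐-trans eq (≐-sym (C.step-product (C.step-fiber-right iab)))))
               (C′.step-product (step-transfer (C.step-fiber-right iab)))

  -- ψ preserves the composition of closure blocks: T i · T j ∋ (a,b) ∈ T k
  -- is an equivalence of a word of length two with one of length four,
  -- which is transported to M′.
  ψ-composition : ∀ i j {k a b a′ b′} → T k a b ≡ true → T′ (ψ k) a′ b′ ≡ true →
    (T i ⋅ T j) a b ≡ true → (T′ (ψ i) ⋅ T′ (ψ j)) a′ b′ ≡ true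
  ψ-composition i j {k} {a} {b} {a′} {b′} tab t′a′b′ e =
    let (c , tiac , tjcb) = ⋅-elim {r = T i} {s = T j} e
        words≈ = C.two-four-words (C.T⇒path tab) (C.path-join (_ ∷ _ ∷ []) (C.T⇒path tiac) (C.T⇒path tjcb))
        path′ = Equivalence.to (C′.sound (≈-transfer words≈) a′ b′)
                  (C′.⋅⇒path₂ (trans (sym (ψ-factor k a′ b′)) t′a′b′))
        (c′ , p₁ , p₂) = C′.path-split (_ ∷ _ ∷ []) path′
    in ⋅-intro {r = T′ (ψ i)} {s = T′ (ψ j)}
         (trans (ψ-factor i a′ c′) (C′.path₂⇒⋅ p₁)) (trans (ψ-factor j c′ b′) (C′.path₂⇒⋅ p₂))

  ψ-left-inverse : (φ⁻¹ : Fin m′ → Fin m) → (∀ x → φ⁻¹ (φ x) ≡ x) → (χ : Fin p′ → Fin p) →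
    (∀ i j k → T′ k ≐ (M′ i ⋅ M′ j) → T (χ k) ≐ (M (φ⁻¹ i) ⋅ M (φ⁻¹ j))) →
    ∀ k → χ (ψ k) ≡ k
  ψ-left-inverse φ⁻¹ φ⁻¹∘φ χ χ-product k =
    C.T-injective (≐-trans (χ-product _ _ (ψ k) (ψ-factor k))
      (subst₂ (λ x y → (M x ⋅ M y) ≐ T k) (sym (φ⁻¹∘φ (C.left k))) (sym (φ⁻¹∘φ (C.right k)))
        (≐-sym (C.T-factor k))))

bijection-inverse : ∀ {m m′} {φ : Fin m → Fin m′} → FD.Bijective _≡_ _≡_ φ →
  ∃ λ (φ⁻¹ : Fin m′ → Fin m) → (∀ x → φ⁻¹ (φ x) ≡ x) × (∀ y → φ (φ⁻¹ y) ≡ y)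
bijection-inverse {m} {m′} {φ} (injective , surjective) = φ⁻¹ , φ⁻¹∘φ , φ∘φ⁻¹
  where
  φ⁻¹ : Fin m′ → Fin m
  φ⁻¹ y = proj₁ (surjective y)
  φ∘φ⁻¹ : ∀ y → φ (φ⁻¹ y) ≡ y
  φ∘φ⁻¹ y = proj₂ (surjective y) refl
  φ⁻¹∘φ : ∀ x → φ⁻¹ (φ x) ≡ x
  φ⁻¹∘φ x = injective (φ∘φ⁻¹ (φ x))

inverse-preserves : ∀ {n m n′ m′} {M : Fam n m} {M′ : Fam n′ m′} {φ : Fin m → Fin m′} {φ⁻¹ : Fin m′ → Fin m} →
  (∀ y → φ (φ⁻¹ y) ≡ y) → PreservesConstants M M′ φ → PreservesConstants M′ M φ⁻¹
inverse-preserves {M = M} {M′} {φ} {φ⁻¹} φ∘φ⁻¹ pres i j k a b a′ b′ r r′ =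
  sym (subst₂ (λ x y → isect (M (φ⁻¹ i)) (M (φ⁻¹ j)) a′ b′ ≡ isect (M′ x) (M′ y) a b)
    (φ∘φ⁻¹ i) (φ∘φ⁻¹ j)
    (pres (φ⁻¹ i) (φ⁻¹ j) (φ⁻¹ k) a′ b′ a b r′ (subst (λ z → M′ z a b ≡ true) (sym (φ∘φ⁻¹ k)) r)))

module ClosureIsomorphism {n m n′ m′ p p′ : ℕ} (M : Fam n m) (M′ : Fam n′ m′) (T : Fam n p) (T′ : Fam n′ p′)
                          (mc : IsMatchingConfiguration M) (sat : Saturated M)
                          (mc′ : IsMatchingConfiguration M′) (sat′ : Saturated M′)
                          (cl : IsCoherentClosure M T) (cl′ : IsCoherentClosure M′ T′)
                          (φ : Fin m → Fin m′) (φ-iso : IsAlgIso M M′ φ) where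

  private
    φ⁻¹ : Fin m′ → Fin m
    φ⁻¹ = proj₁ (bijection-inverse (proj₁ φ-iso))
    φ⁻¹∘φ : ∀ x → φ⁻¹ (φ x) ≡ x
    φ⁻¹∘φ = proj₁ (proj₂ (bijection-inverse (proj₁ φ-iso)))
    φ∘φ⁻¹ : ∀ y → φ (φ⁻¹ y) ≡ y
    φ∘φ⁻¹ = proj₂ (proj₂ (bijection-inverse (proj₁ φ-iso)))
    module F = ClosureMap M M′ T T′ mc sat mc′ sat′ cl cl′ φ (proj₂ φ-iso)
    module B = ClosureMap M′ M T′ T mc′ sat′ mc sat cl′ cl φ⁻¹ (inverse-preserves φ∘φ⁻¹ (proj₂ φ-iso))

  open F public using (ψ; ψ-product; ψ-basis)

  B∘ψ : ∀ k → B.ψ (ψ k) ≡ k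
  B∘ψ = F.ψ-left-inverse φ⁻¹ φ⁻¹∘φ B.ψ B.ψ-product

  ψ∘B : ∀ k → ψ (B.ψ k) ≡ k
  ψ∘B = B.ψ-left-inverse φ φ∘φ⁻¹ ψ F.ψ-product

  ψ-bijective : FD.Bijective _≡_ _≡_ ψ
  ψ-bijective = inverseᵇ⇒bijective ((λ { refl → ψ∘B _ }) , (λ { refl → B∘ψ _ }))

  -- Closure blocks are functional, so their structure constants are decided
  -- by composition, which ψ preserves in both directions.
  ψ-preserves : PreservesConstants T T′ ψ
  ψ-preserves i j k a b a′ b′ tab t′a′b′ =
    isect-functional-≡ {r = T i} {T j} {T′ (ψ i)} {T′ (ψ j)} (F.C.T-functional i) (F.C′.T-functional (ψ i))
      (F.ψ-composition i j tab t′a′b′)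
      (λ e → subst₂ (λ x y → (T x ⋅ T y) a b ≡ true) (B∘ψ i) (B∘ψ j)
               (B.ψ-composition (ψ i) (ψ j) t′a′b′ (subst (λ x → T x a b ≡ true) (sym (B∘ψ k)) tab) e))

theorem4p6 : ∀ {n m n' m' p p'}
    (M : Fam n m) (M' : Fam n' m') (T : Fam n p) (T' : Fam n' p')
    (φ : Fin m → Fin m') →
    IsMatchingConfiguration M → Saturated M →
    IsMatchingConfiguration M' → Saturated M' →
    IsCoherentClosure M T → IsCoherentClosure M' T' →
    IsAlgIso M M' φ →
    IsNonEmptyProducts M T × IsNonEmptyProducts M' T' ×
    (∃ λ (ψ : Fin p → Fin p') →
      (∀ i j k → T k ≐ (M i ⋅ M j) → T' (ψ k) ≐ (M' (φ i) ⋅ M' (φ j))) ×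
      (∀ i k → T k ≐ M i → T' (ψ k) ≐ M' (φ i)) ×
      IsAlgIso T T' ψ)
theorem4p6 M M′ T T′ φ mc sat mc′ sat′ cl cl′ φ-iso =
  Closure.closure-products M mc sat T cl ,
  Closure.closure-products M′ mc′ sat′ T′ cl′ ,
  ψ , ψ-product , ψ-basis , ψ-bijective , ψ-preserves
  where open ClosureIsomorphism M M′ T T′ mc sat mc′ sat′ cl cl′ φ φ-iso
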